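{- Let $(S,\ell)$ be a sticky tree and let $v$ be a node of $S$ with label $\ell(v)=d\geq 1$. Then the unique ancestor $u$ of $v$ of depth $d$ (where $u=v$ is allowed) is a primary node.
   Context: A plane tree is a rooted tree in which the children of every node are linearly ordered from left to right. The root has depth $0$. The prefix order of a plane tree is defined recursively: the root, followed by the prefix orders of the subtrees of its children taken from left to right. For a node $u$, $S_u$ denotes the subtree rooted at $u$ (containing $u$). A sticky tree is a plane tree $S=(V,E)$ with a labeling $\ell:V\to\mathbb{N}$ such that: (1) every node $u$ of depth $d$ satisfies $0\le \ell(u)\le d$; (2) for every node $u$ of depth $d>0$ there is a node $v\in S_u$ (possibly $v=u$) with $\ell(v)<d$; (3) for every node $u$ of depth $d$, if some $v\in S_u$ has $\ell(v)=d$, then every node of $S_u$ (including $u$) that precedes $v$ in prefix order has label at least $d$. A non-root node is primary if its label equals its depth; the other non-root nodes are derived. Such an ancestor $u$ exists since $\ell(v)\le$ depth of $v$. -}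

module Defs where

open import Data.Nat using (ℕ; zero; suc; _≤_; _<_)
open import Data.List using (List; []; _∷_; _++_; length)
open import Data.Maybe using (Maybe; just; nothing)
open import Data.Product using (Σ; ∃; _×_; _,_)
open import Relation.Binary.PropositionalEquality using (_≡_)

data Tree : Set where
  node : ℕ → List Tree → Tree

-- Nodes are addressed by their path from the root: a list of child
-- indices (0 = leftmost child).  The root is [], depth = length of path.
Addr : Set
Addr = List ℕ

depth : Addr → ℕ
depth = length

mutual
  subtreeAt : Tree → Addr → Maybe Tree
  subtreeAt t [] = just t
  subtreeAt (node a ts) (i ∷ p) = childAt ts i p

  childAt : List Tree → ℕ → Addr → Maybe Tree
  childAt [] i p = nothing
  childAt (t ∷ ts) zero p = subtreeAt t p
  childAt (t ∷ ts) (suc i) p = childAt ts i p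

rootLabel : Tree → ℕ
rootLabel (node a _) = a

-- label t p ≡ just n  iff  p is a node of t with label n;
-- label t p ≡ nothing iff p is not a node of t.
label : Tree → Addr → Maybe ℕ
label t p with subtreeAt t p
... | just s  = just (rootLabel s)
... | nothing = nothing

-- Strict prefix (preorder) order on addresses: an ancestor precedes its
-- descendants; otherwise compare at the first differing child index.
data _≺_ : Addr → Addr → Set where
  root≺ : ∀ {x xs} → [] ≺ (x ∷ xs)
  left≺ : ∀ {x y xs ys} → x < y → (x ∷ xs) ≺ (y ∷ ys)
  same≺ : ∀ {x xs ys} → xs ≺ ys → (x ∷ xs) ≺ (x ∷ ys)

-- Sticky tree conditions (1)-(3).  Nodes of S_u are exactly the addresses
-- u ++ w that are nodes of t.
record Sticky (t : Tree) : Set where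
  field
    cond1 : ∀ u n → label t u ≡ just n → n ≤ depth u
    cond2 : ∀ u n → label t u ≡ just n → 0 < depth u →
            Σ Addr λ w → Σ ℕ λ m → label t (u ++ w) ≡ just m × m < depth u
    cond3 : ∀ u w → label t (u ++ w) ≡ just (depth u) →
            ∀ w' m → label t (u ++ w') ≡ just m → (u ++ w') ≺ (u ++ w) →
            depth u ≤ m

Primary : Tree → Addr → Set
Primary t u = 0 < depth u × label t u ≡ just (depth u)

-- Let u be the ancestor of v at depth d = ℓ(v).  Condition (1) gives ℓ(u) ≤ d.
-- If u ≠ v, then v is a node of S_u labelled d = depth u, and u precedes v in
-- prefix order, so condition (3) gives ℓ(u) ≥ d.  Hence ℓ(u) = d and, d being
-- positive, u is primary.
module Submission where

open import Defs
open import Data.Nat using (ℕ; _≤_; zero; suc)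
open import Data.Nat.Properties using (≤-antisym; m≤n⇒m⊓n≡m)
open import Data.List using ([]; _∷_; _++_; take; drop)
open import Data.List.Properties using (++-identityʳ; take++drop≡id; length-take)
open import Data.Maybe using (just; nothing)
open import Data.Product using (Σ; ∃; _×_; _,_)
open import Relation.Binary.PropositionalEquality

mutual
  subtreeAt-++⁻ : ∀ t u w {s} → subtreeAt t (u ++ w) ≡ just s → ∃ λ s′ → subtreeAt t u ≡ just s′
  subtreeAt-++⁻ t           []      w _  = t , refl
  subtreeAt-++⁻ (node _ ts) (i ∷ u) w eq = childAt-++⁻ ts i u w eq

  childAt-++⁻ : ∀ ts i u w {s} → childAt ts i (u ++ w) ≡ just s → ∃ λ s′ → childAt ts i u ≡ just s′
  childAt-++⁻ []       i       u w ()
  childAt-++⁻ (t ∷ ts) zero    u w eq = subtreeAt-++⁻ t u w eq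
  childAt-++⁻ (t ∷ ts) (suc i) u w eq = childAt-++⁻ ts i u w eq

label≡just⇒subtreeAt : ∀ t p {n} → label t p ≡ just n → ∃ λ s → subtreeAt t p ≡ just s
label≡just⇒subtreeAt t p eq with subtreeAt t p
... | just s  = s , refl
label≡just⇒subtreeAt t p () | nothing

subtreeAt⇒label≡just : ∀ t p {s} → subtreeAt t p ≡ just s → label t p ≡ just (rootLabel s)
subtreeAt⇒label≡just t p eq with subtreeAt t p
subtreeAt⇒label≡just t p refl | just _ = refl

label-++⁻ : ∀ t u w {n} → label t (u ++ w) ≡ just n → ∃ λ m → label t u ≡ just m
label-++⁻ t u w eq with label≡just⇒subtreeAt t (u ++ w) eq
... | _ , sub with subtreeAt-++⁻ t u w sub
...   | s , subᵤ = rootLabel s , subtreeAt⇒label≡just t u subᵤ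

≺-++ : ∀ u x xs → u ≺ (u ++ x ∷ xs)
≺-++ []      x xs = root≺
≺-++ (y ∷ u) x xs = same≺ (≺-++ u x xs)

ancestorAtDepth : ∀ (v : Addr) {d} → d ≤ depth v → Σ Addr λ u → Σ Addr λ w → v ≡ u ++ w × depth u ≡ d
ancestorAtDepth v {d} d≤∣v∣ =
  take d v , drop d v , sym (take++drop≡id d v) , trans (length-take d v) (m≤n⇒m⊓n≡m d≤∣v∣)

module _ {t : Tree} (sticky : Sticky t) where
  open Sticky sticky

  label-ancestor≡depth : ∀ u w → label t (u ++ w) ≡ just (depth u) → label t u ≡ just (depth u)
  label-ancestor≡depth u []       lv = subst (λ p → label t p ≡ just (depth u)) (++-identityʳ u) lv
  label-ancestor≡depth u (x ∷ xs) lv with label-++⁻ t u (x ∷ xs) lv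
  ... | m , lu = trans lu (cong just (≤-antisym (cond1 u m lu) (cond3 u (x ∷ xs) lv [] m lu′ u≺v)))
    where
    lu′ : label t (u ++ []) ≡ just m
    lu′ = subst (λ p → label t p ≡ just m) (sym (++-identityʳ u)) lu
    u≺v : (u ++ []) ≺ (u ++ x ∷ xs)
    u≺v = subst (_≺ (u ++ x ∷ xs)) (sym (++-identityʳ u)) (≺-++ u x xs)

lemma2p1 : (t : Tree) → Sticky t → (v : Addr) (d : ℕ) → label t v ≡ just d → 1 ≤ d →
    (Σ Addr λ u → Σ Addr λ w → v ≡ u ++ w × depth u ≡ d)
    × (∀ u w → v ≡ u ++ w → depth u ≡ d → Primary t u)
lemma2p1 t sticky v d lv 1≤d = ancestorAtDepth v (Sticky.cond1 sticky v d lv) , primary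
  where
  primary : ∀ u w → v ≡ u ++ w → depth u ≡ d → Primary t u
  primary u w refl refl = 1≤d , label-ancestor≡depth sticky u w lv
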